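{- Let $G$ be a Random Apollonian Network and let $T$ be its $\triangle$-tree. Let $\langle\triangle\rangle$ be a node of $T$ with nine grandchildren $\langle\triangle_1\rangle,\dots,\langle\triangle_9\rangle$. Then the vertex set of any path in $G$ does not intersect all of the sets $I(\triangle_1),\dots,I(\triangle_9)$.
   Context: A Random Apollonian Network (RAN) is built by starting with a triangle $\nu_1\nu_2\nu_3$ embedded in the plane and repeatedly choosing a bounded face uniformly at random, adding a vertex inside it and joining it to the three vertices of that face (subdividing the face). The $\triangle$-tree $T$ of $G$ is the rooted tree whose nodes correspond bijectively to the triangles occurring during the process: the root corresponds to $\nu_1\nu_2\nu_3$, and whenever a triangle $\triangle$ is subdivided into $\triangle_1,\triangle_2,\triangle_3$, the node $\langle\triangle\rangle$ receives the three children $\langle\triangle_1\rangle,\langle\triangle_2\rangle,\langle\triangle_3\rangle$. Grandchildren of a node are the children of its children. For a triangle $\triangle$, $I(\triangle)$ is the set of vertices of $G$ strictly inside $\triangle$. A path means a simple path. -}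

module Defs where

open import Data.Nat using (ℕ)
open import Data.List using (List; []; _∷_; _++_)
open import Data.List.Membership.Propositional using (_∈_)
open import Data.List.Relation.Unary.All using (All)
open import Data.List.Relation.Unary.Linked using (Linked)
open import Data.List.Relation.Unary.Unique.Propositional using (Unique)
open import Data.Product using (Σ; _×_; ∃-syntax)
open import Data.Sum using (_⊎_)

-- A (realisation of an) Apollonian network is determined by its outer
-- triangle (a , b , c) (three vertex labels) and its △-tree.
-- The subtree rooted at a triangle (a , b , c) is either a leaf (the
-- triangle is a face that was never subdivided) or  node v t₁ t₂ t₃ :
-- vertex v was inserted into (a , b , c), producing the three triangles
-- (v , b , c), (a , v , c), (a , b , v) whose △-subtrees are t₁ t₂ t₃.
data Tri : Set where
  leaf : Tri
  node : (v : ℕ) (t₁ t₂ t₃ : Tri) → Tri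

-- Vertices strictly inside the triangle of a △-subtree: I(△).
labels : Tri → List ℕ
labels leaf = []
labels (node v t₁ t₂ t₃) = v ∷ (labels t₁ ++ labels t₂ ++ labels t₃)

data EdgeIn : ℕ → ℕ → ℕ → Tri → ℕ → ℕ → Set where
  new-a : ∀ {a b c v t₁ t₂ t₃} → EdgeIn a b c (node v t₁ t₂ t₃) v a
  new-b : ∀ {a b c v t₁ t₂ t₃} → EdgeIn a b c (node v t₁ t₂ t₃) v b
  new-c : ∀ {a b c v t₁ t₂ t₃} → EdgeIn a b c (node v t₁ t₂ t₃) v c
  in₁ : ∀ {a b c v t₁ t₂ t₃ x y} → EdgeIn v b c t₁ x y → EdgeIn a b c (node v t₁ t₂ t₃) x y
  in₂ : ∀ {a b c v t₁ t₂ t₃ x y} → EdgeIn a v c t₂ x y → EdgeIn a b c (node v t₁ t₂ t₃) x y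
  in₃ : ∀ {a b c v t₁ t₂ t₃ x y} → EdgeIn a b v t₃ x y → EdgeIn a b c (node v t₁ t₂ t₃) x y

data Edge (a b c : ℕ) (t : Tri) : ℕ → ℕ → Set where
  ab : Edge a b c t a b
  bc : Edge a b c t b c
  ca : Edge a b c t c a
  inner : ∀ {x y} → EdgeIn a b c t x y → Edge a b c t x y

Adj : ℕ → ℕ → ℕ → Tri → ℕ → ℕ → Set
Adj a b c t x y = Edge a b c t x y ⊎ Edge a b c t y x

Vertex : ℕ → ℕ → ℕ → Tri → ℕ → Set
Vertex a b c t x = x ∈ (a ∷ b ∷ c ∷ labels t)

WellFormed : ℕ → ℕ → ℕ → Tri → Set
WellFormed a b c t = Unique (a ∷ b ∷ c ∷ labels t)

IsPath : ℕ → ℕ → ℕ → Tri → List ℕ → Set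
IsPath a b c t p = Unique p × Linked (Adj a b c t) p × All (Vertex a b c t) p

-- Node of the △-tree: Sub a b c t x y z s  means the triangle (x , y , z)
-- with △-subtree s occurs in the △-tree t of triangle (a , b , c).
data Sub : ℕ → ℕ → ℕ → Tri → ℕ → ℕ → ℕ → Tri → Set where
  here : ∀ {a b c t} → Sub a b c t a b c t
  sub₁ : ∀ {a b c v t₁ t₂ t₃ x y z s} → Sub v b c t₁ x y z s → Sub a b c (node v t₁ t₂ t₃) x y z s
  sub₂ : ∀ {a b c v t₁ t₂ t₃ x y z s} → Sub a v c t₂ x y z s → Sub a b c (node v t₁ t₂ t₃) x y z s
  sub₃ : ∀ {a b c v t₁ t₂ t₃ x y z s} → Sub a b v t₃ x y z s → Sub a b c (node v t₁ t₂ t₃) x y z s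

Meets : List ℕ → Tri → Set
Meets p g = ∃[ w ] (w ∈ p × w ∈ labels g)

module Submission where

-- The proof is a pigeonhole argument.  Call the seven vertices x, y, z (the
-- corners of △), v (inserted into △) and v₁, v₂, v₃ (inserted into its
-- children) the gates.  The corners of every grandchild are gates, and a
-- neighbour of an interior vertex of a triangle lies in the closed triangle,
-- so a path can only step into a grandchild's interior from a gate or by
-- starting there.  Labelling each region met by the gate through which the
-- path enters it (or by "start") gives an injection, because on a simple path
-- a gate has a unique successor and the nine interiors are disjoint; hence at
-- most 7 + 1 = 8 regions are met.

open import Defs
open import Data.Nat using (ℕ; suc; _≤_)
open import Data.Nat.Properties using (≮⇒≥; n≮n)
open import Data.Fin using (Fin; zero; suc)
open import Data.Fin.Properties using (pigeonhole; <⇒≢; suc-injective)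
open import Data.List using (List; []; _∷_; _++_; concat; length; lookup; map)
open import Data.List.Properties using (++-assoc; ++-identityʳ)
open import Data.List.Relation.Unary.Any using (here; there; index)
open import Data.List.Relation.Unary.All as All using (All; []; _∷_)
open import Data.List.Relation.Unary.All.Properties using (++⁻ˡ; map⁺)
open import Data.List.Relation.Unary.Linked using (Linked; _∷_)
open import Data.List.Relation.Unary.Unique.Propositional using (Unique; []; _∷_)
open import Data.List.Relation.Unary.Unique.Propositional.Properties using (Unique[x∷xs]⇒x∉xs)
open import Data.List.Relation.Binary.Disjoint.Propositional using (Disjoint)
open import Data.List.Relation.Binary.Disjoint.Propositional.Properties using () renaming (sym to Disjoint-sym)
open import Data.List.Relation.Binary.Sublist.Propositional using (_⊆_; []; _∷_; _∷ʳ_; ⊆-refl)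
open import Data.List.Relation.Binary.Sublist.Propositional.Properties using (All-resp-⊆; ++⁺)
open import Data.List.Membership.Propositional using (_∈_; _∉_)
open import Data.List.Membership.Propositional.Properties using (∈-++⁺ˡ; ∈-++⁺ʳ; ∈-concat⁺′; ∈-lookup)
open import Data.List.Membership.Setoid.Properties using (index-injective)
open import Data.Product as Product using (_×_; _,_; ∃-syntax; proj₁; proj₂)
open import Data.Sum as Sum using (_⊎_; inj₁; inj₂)
open import Data.Empty using (⊥; ⊥-elim)
open import Function using (_∘_; id)
open import Relation.Nullary using (¬_)
open import Relation.Binary.PropositionalEquality using (_≡_; refl; sym; trans; cong; subst; setoid)

module _ {A : Set} where

  Unique-++⁻ : ∀ (xs : List A) {ys} → Unique (xs ++ ys) → Unique xs × Unique ys × Disjoint xs ys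
  Unique-++⁻ [] u = [] , u , λ ()
  Unique-++⁻ (x ∷ xs) (x∉ ∷ u) with Unique-++⁻ xs u
  ... | uxs , uys , disjoint = ++⁻ˡ xs x∉ ∷ uxs , uys , λ where
        (here refl , x∈ys) → All.lookup x∉ (∈-++⁺ʳ xs x∈ys) refl
        (there w∈xs , w∈ys) → disjoint (w∈xs , w∈ys)

  Unique-⊆ : ∀ {xs ys : List A} → xs ⊆ ys → Unique ys → Unique xs
  Unique-⊆ [] [] = []
  Unique-⊆ (y ∷ʳ xs⊆ys) (_ ∷ u) = Unique-⊆ xs⊆ys u
  Unique-⊆ (refl ∷ xs⊆ys) (x∉ ∷ u) = All-resp-⊆ xs⊆ys x∉ ∷ Unique-⊆ xs⊆ys u

  blocks-disjoint : ∀ (Ls : List (List A)) → Unique (concat Ls) →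
                    ∀ {i j w} → w ∈ lookup Ls i → w ∈ lookup Ls j → i ≡ j
  blocks-disjoint (L ∷ Ls) u {zero} {zero} _ _ = refl
  blocks-disjoint (L ∷ Ls) u {zero} {suc j} w∈i w∈j =
    ⊥-elim (Unique-++⁻ L u .proj₂ .proj₂ (w∈i , ∈-concat⁺′ w∈j (∈-lookup {xs = Ls} j)))
  blocks-disjoint (L ∷ Ls) u {suc i} {zero} w∈i w∈j =
    ⊥-elim (Unique-++⁻ L u .proj₂ .proj₂ (w∈j , ∈-concat⁺′ w∈i (∈-lookup {xs = Ls} i)))
  blocks-disjoint (L ∷ Ls) u {suc i} {suc j} w∈i w∈j =
    cong suc (blocks-disjoint Ls (Unique-++⁻ L u .proj₂ .proj₁) w∈i w∈j)

  skip-before : ∀ (u : A) L₁ L₂ L₃ {xs ys} → xs ⊆ ys → L₁ ++ L₂ ++ L₃ ++ xs ⊆ (u ∷ L₁ ++ L₂ ++ L₃) ++ ys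
  skip-before u L₁ L₂ L₃ {xs} {ys} xs⊆ys =
    u ∷ʳ subst (L₁ ++ L₂ ++ L₃ ++ xs ⊆_) (sym reassociate)
               (++⁺ (⊆-refl {x = L₁}) (++⁺ (⊆-refl {x = L₂}) (++⁺ (⊆-refl {x = L₃}) xs⊆ys)))
    where
    reassociate : (L₁ ++ L₂ ++ L₃) ++ ys ≡ L₁ ++ L₂ ++ L₃ ++ ys
    reassociate = trans (++-assoc L₁ (L₂ ++ L₃) ys) (cong (L₁ ++_) (++-assoc L₂ L₃ ys))

  corner-or-interior : ∀ {x y z u : A} {L S : List A} →
                       x ∈ S → y ∈ S → z ∈ S → u ∈ x ∷ y ∷ z ∷ L → u ∈ L ⊎ u ∈ S
  corner-or-interior x∈ _ _ (here refl) = inj₂ x∈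
  corner-or-interior _ y∈ _ (there (here refl)) = inj₂ y∈
  corner-or-interior _ _ z∈ (there (there (here refl))) = inj₂ z∈
  corner-or-interior _ _ _ (there (there (there u∈L))) = inj₁ u∈L

  data _⇢_∈_ (u w : A) : List A → Set where
    here  : ∀ {xs} → u ⇢ w ∈ (u ∷ w ∷ xs)
    there : ∀ {x xs} → u ⇢ w ∈ xs → u ⇢ w ∈ (x ∷ xs)

  ⇢-source : ∀ {u w xs} → u ⇢ w ∈ xs → u ∈ xs
  ⇢-source here = here refl
  ⇢-source (there u⇢w) = there (⇢-source u⇢w)

  successor-unique : ∀ {u w w′ xs} → Unique xs → u ⇢ w ∈ xs → u ⇢ w′ ∈ xs → w ≡ w′
  successor-unique _ here here = refl
  successor-unique u here (there u⇢w′) = ⊥-elim (Unique[x∷xs]⇒x∉xs u (⇢-source u⇢w′))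
  successor-unique u (there u⇢w) here = ⊥-elim (Unique[x∷xs]⇒x∉xs u (⇢-source u⇢w))
  successor-unique (_ ∷ u) (there u⇢w) (there u⇢w′) = successor-unique u u⇢w u⇢w′

module Gates {A : Set} (_~_ : A → A → Set) (gates : List A) where

  Enclosed : List A → Set
  Enclosed L = ∀ {u w} → u ~ w → w ∈ L → u ∈ L ⊎ u ∈ gates

  data Entry (L : List A) : List A → Set where
    start : ∀ {w p} → w ∈ L → Entry L (w ∷ p)
    via   : ∀ {g w p} → g ∈ gates → g ⇢ w ∈ p → w ∈ L → Entry L p

  extend : ∀ {L u w p} → Enclosed L → u ~ w → Entry L (w ∷ p) → Entry L (u ∷ w ∷ p)
  extend enclosed u~w (start w∈L) = Sum.[ start , (λ u∈gates → via u∈gates here w∈L) ] (enclosed u~w w∈L)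
  extend _ _ (via g∈ g⇢w w∈L) = via g∈ (there g⇢w) w∈L

  entry : ∀ {L p w} → Enclosed L → Linked _~_ p → w ∈ p → w ∈ L → Entry L p
  entry _ _ (here refl) w∈L = start w∈L
  entry enclosed (u~ ∷ walk) (there w∈p) w∈L = extend enclosed u~ (entry enclosed walk w∈p w∈L)

  label : ∀ {L p} → Entry L p → Fin (suc (length gates))
  label (start _) = zero
  label (via g∈ _ _) = suc (index g∈)

  label-injective : ∀ {L L′ p} → Unique p → (e : Entry L p) (e′ : Entry L′ p) →
                    label e ≡ label e′ → ∃[ w ] (w ∈ L × w ∈ L′)
  label-injective _ (start w∈L) (start w∈L′) _ = _ , w∈L , w∈L′
  label-injective simple (via g∈ g⇢w w∈L) (via g′∈ g′⇢w′ w′∈L′) same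
    with index-injective (setoid A) g∈ g′∈ (suc-injective same)
  ... | refl rewrite successor-unique simple g⇢w g′⇢w′ = _ , w∈L , w′∈L′

  regions-met-bound : (Ls : List (List A)) → All Enclosed Ls → Unique (concat Ls) →
                      ∀ {p} → Unique p → Linked _~_ p →
                      All (λ L → ∃[ w ] (w ∈ p × w ∈ L)) Ls →
                      length Ls ≤ suc (length gates)
  regions-met-bound Ls enclosed disjoint {p} simple walk meets = ≮⇒≥ λ more-regions →
    let i , j , i<j , same = pigeonhole more-regions (label ∘ entry-of)
        _ , w∈i , w∈j = label-injective simple (entry-of i) (entry-of j) same
    in <⇒≢ i<j (blocks-disjoint Ls disjoint w∈i w∈j)
    where
    entry-of : (i : Fin (length Ls)) → Entry (lookup Ls i) p
    entry-of i with All.lookup meets (∈-lookup i)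
    ... | w , w∈p , w∈L = entry (All.lookup enclosed (∈-lookup i)) walk w∈p w∈L

vertices : ℕ → ℕ → ℕ → Tri → List ℕ
vertices a b c t = a ∷ b ∷ c ∷ labels t

record Fresh (a b c : ℕ) (t : Tri) : Set where
  field
    unique  : Unique (labels t)
    outside : Disjoint (a ∷ b ∷ c ∷ []) (labels t)
open Fresh

wellFormed⇒fresh : ∀ {a b c t} → WellFormed a b c t → Fresh a b c t
wellFormed⇒fresh {a} {b} {c} wf =
  let _ , unique-interior , corners-outside = Unique-++⁻ (a ∷ b ∷ c ∷ []) wf
  in record { unique = unique-interior ; outside = corners-outside }

module Node (a b c v : ℕ) (t₁ t₂ t₃ : Tri) where

  apexes : List ℕ
  apexes = a ∷ b ∷ c ∷ v ∷ []

  v-apex : v ∈ apexes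
  v-apex = there (there (there (here refl)))

  children : List ℕ
  children = labels t₁ ++ labels t₂ ++ labels t₃

  inner₁ : ∀ {w} → w ∈ labels t₁ → w ∈ children
  inner₁ = ∈-++⁺ˡ
  inner₂ : ∀ {w} → w ∈ labels t₂ → w ∈ children
  inner₂ = ∈-++⁺ʳ (labels t₁) ∘ ∈-++⁺ˡ
  inner₃ : ∀ {w} → w ∈ labels t₃ → w ∈ children
  inner₃ = ∈-++⁺ʳ (labels t₁) ∘ ∈-++⁺ʳ (labels t₂)

  split₁ : ∀ {u} → u ∈ vertices v b c t₁ → u ∈ labels t₁ ⊎ u ∈ apexes
  split₁ = corner-or-interior (there (there (there (here refl)))) (there (here refl)) (there (there (here refl)))
  split₂ : ∀ {u} → u ∈ vertices a v c t₂ → u ∈ labels t₂ ⊎ u ∈ apexes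
  split₂ = corner-or-interior (here refl) (there (there (there (here refl)))) (there (there (here refl)))
  split₃ : ∀ {u} → u ∈ vertices a b v t₃ → u ∈ labels t₃ ⊎ u ∈ apexes
  split₃ = corner-or-interior (here refl) (there (here refl)) (there (there (there (here refl))))

  private
    to-node : ∀ {u} {L : List ℕ} → (∀ {w} → w ∈ L → w ∈ children) →
              u ∈ L ⊎ u ∈ apexes → u ∈ vertices a b c (node v t₁ t₂ t₃)
    to-node embed = Sum.[ ∈-++⁺ʳ apexes ∘ embed , ∈-++⁺ˡ ]

  widen₁ : ∀ {u} → u ∈ vertices v b c t₁ → u ∈ vertices a b c (node v t₁ t₂ t₃)
  widen₁ = to-node inner₁ ∘ split₁
  widen₂ : ∀ {u} → u ∈ vertices a v c t₂ → u ∈ vertices a b c (node v t₁ t₂ t₃)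
  widen₂ = to-node inner₂ ∘ split₂
  widen₃ : ∀ {u} → u ∈ vertices a b v t₃ → u ∈ vertices a b c (node v t₁ t₂ t₃)
  widen₃ = to-node inner₃ ∘ split₃

edge-ends : ∀ {a b c t p q} → EdgeIn a b c t p q → p ∈ vertices a b c t × q ∈ vertices a b c t
edge-ends new-a = there (there (there (here refl))) , here refl
edge-ends new-b = there (there (there (here refl))) , there (here refl)
edge-ends new-c = there (there (there (here refl))) , there (there (here refl))
edge-ends (in₁ {a} {b} {c} {v} {t₁} {t₂} {t₃} e) = Product.map widen₁ widen₁ (edge-ends e)
  where open Node a b c v t₁ t₂ t₃
edge-ends (in₂ {a} {b} {c} {v} {t₁} {t₂} {t₃} e) = Product.map widen₂ widen₂ (edge-ends e)
  where open Node a b c v t₁ t₂ t₃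
edge-ends (in₃ {a} {b} {c} {v} {t₁} {t₂} {t₃} e) = Product.map widen₃ widen₃ (edge-ends e)
  where open Node a b c v t₁ t₂ t₃

untouched : ∀ {x y z s p q} {L : List ℕ} → (∀ {u} → u ∈ vertices x y z s → u ∉ L) →
            EdgeIn x y z s p q → p ∈ L ⊎ q ∈ L → ⊥
untouched avoid e = Sum.[ avoid (proj₁ (edge-ends e)) , avoid (proj₂ (edge-ends e)) ]

module FreshNode {a b c v : ℕ} {t₁ t₂ t₃ : Tri} (fresh : Fresh a b c (node v t₁ t₂ t₃)) where
  open Node a b c v t₁ t₂ t₃

  private
    split-1|23 : Unique (labels t₁) × Unique (labels t₂ ++ labels t₃) × Disjoint (labels t₁) (labels t₂ ++ labels t₃)
    split-1|23 = Unique-++⁻ (labels t₁) (Unique-++⁻ (v ∷ []) (unique fresh) .proj₂ .proj₁)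
    split-2|3 : Unique (labels t₂) × Unique (labels t₃) × Disjoint (labels t₂) (labels t₃)
    split-2|3 = Unique-++⁻ (labels t₂) (split-1|23 .proj₂ .proj₁)

  apex-outside : ∀ {u} → u ∈ apexes → u ∉ children
  apex-outside (here refl) u∈ = outside fresh (here refl , there u∈)
  apex-outside (there (here refl)) u∈ = outside fresh (there (here refl) , there u∈)
  apex-outside (there (there (here refl))) u∈ = outside fresh (there (there (here refl)) , there u∈)
  apex-outside (there (there (there (here refl)))) = Unique[x∷xs]⇒x∉xs (unique fresh)

  disjoint₁₂ : Disjoint (labels t₁) (labels t₂)
  disjoint₁₂ (w∈₁ , w∈₂) = split-1|23 .proj₂ .proj₂ (w∈₁ , ∈-++⁺ˡ w∈₂)
  disjoint₁₃ : Disjoint (labels t₁) (labels t₃)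
  disjoint₁₃ (w∈₁ , w∈₃) = split-1|23 .proj₂ .proj₂ (w∈₁ , ∈-++⁺ʳ (labels t₂) w∈₃)
  disjoint₂₃ : Disjoint (labels t₂) (labels t₃)
  disjoint₂₃ = split-2|3 .proj₂ .proj₂

  fresh₁ : Fresh v b c t₁
  fresh₁ = record { unique = split-1|23 .proj₁ ; outside = λ where
    (here refl , w∈) → apex-outside v-apex (inner₁ w∈)
    (there corner , w∈) → outside fresh (there corner , there (inner₁ w∈)) }
  fresh₂ : Fresh a v c t₂
  fresh₂ = record { unique = split-2|3 .proj₁ ; outside = λ where
    (there (here refl) , w∈) → apex-outside v-apex (inner₂ w∈)
    (here refl , w∈) → outside fresh (here refl , there (inner₂ w∈))
    (there (there corner) , w∈) → outside fresh (there (there corner) , there (inner₂ w∈)) }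
  fresh₃ : Fresh a b v t₃
  fresh₃ = record { unique = split-2|3 .proj₂ .proj₁ ; outside = λ where
    (there (there (here refl)) , w∈) → apex-outside v-apex (inner₃ w∈)
    (here refl , w∈) → outside fresh (here refl , there (inner₃ w∈))
    (there (here refl) , w∈) → outside fresh (there (here refl) , there (inner₃ w∈)) }

  private
    apart : ∀ {Lᵢ Lⱼ : List ℕ} {u} → Disjoint Lᵢ Lⱼ → (∀ {w} → w ∈ Lᵢ → w ∈ children) →
            u ∈ Lⱼ ⊎ u ∈ apexes → u ∉ Lᵢ
    apart disjoint _ (inj₁ u∈ⱼ) u∈ᵢ = disjoint (u∈ᵢ , u∈ⱼ)
    apart _ embed (inj₂ apex) u∈ᵢ = apex-outside apex (embed u∈ᵢ)

    -- The edges created at the node join v to an apex, so touch no child interior.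
    new-edge : ∀ {u} {L : List ℕ} → (∀ {w} → w ∈ L → w ∈ children) → u ∈ apexes → v ∈ L ⊎ u ∈ L → ⊥
    new-edge embed apex = Sum.[ apex-outside v-apex ∘ embed , apex-outside apex ∘ embed ]

  edge-in₁ : ∀ {p q} → EdgeIn a b c (node v t₁ t₂ t₃) p q → p ∈ labels t₁ ⊎ q ∈ labels t₁ → EdgeIn v b c t₁ p q
  edge-in₁ new-a h = ⊥-elim (new-edge inner₁ (here refl) h)
  edge-in₁ new-b h = ⊥-elim (new-edge inner₁ (there (here refl)) h)
  edge-in₁ new-c h = ⊥-elim (new-edge inner₁ (there (there (here refl))) h)
  edge-in₁ (in₁ e) _ = e
  edge-in₁ (in₂ e) h = ⊥-elim (untouched (apart disjoint₁₂ inner₁ ∘ split₂) e h)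
  edge-in₁ (in₃ e) h = ⊥-elim (untouched (apart disjoint₁₃ inner₁ ∘ split₃) e h)

  edge-in₂ : ∀ {p q} → EdgeIn a b c (node v t₁ t₂ t₃) p q → p ∈ labels t₂ ⊎ q ∈ labels t₂ → EdgeIn a v c t₂ p q
  edge-in₂ new-a h = ⊥-elim (new-edge inner₂ (here refl) h)
  edge-in₂ new-b h = ⊥-elim (new-edge inner₂ (there (here refl)) h)
  edge-in₂ new-c h = ⊥-elim (new-edge inner₂ (there (there (here refl))) h)
  edge-in₂ (in₁ e) h = ⊥-elim (untouched (apart (Disjoint-sym disjoint₁₂) inner₂ ∘ split₁) e h)
  edge-in₂ (in₂ e) _ = e
  edge-in₂ (in₃ e) h = ⊥-elim (untouched (apart disjoint₂₃ inner₂ ∘ split₃) e h)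

  edge-in₃ : ∀ {p q} → EdgeIn a b c (node v t₁ t₂ t₃) p q → p ∈ labels t₃ ⊎ q ∈ labels t₃ → EdgeIn a b v t₃ p q
  edge-in₃ new-a h = ⊥-elim (new-edge inner₃ (here refl) h)
  edge-in₃ new-b h = ⊥-elim (new-edge inner₃ (there (here refl)) h)
  edge-in₃ new-c h = ⊥-elim (new-edge inner₃ (there (there (here refl))) h)
  edge-in₃ (in₁ e) h = ⊥-elim (untouched (apart (Disjoint-sym disjoint₁₃) inner₃ ∘ split₁) e h)
  edge-in₃ (in₂ e) h = ⊥-elim (untouched (apart (Disjoint-sym disjoint₂₃) inner₃ ∘ split₂) e h)
  edge-in₃ (in₃ e) _ = e

Sub-trans : ∀ {a b c t x y z s x′ y′ z′ s′} →
            Sub a b c t x y z s → Sub x y z s x′ y′ z′ s′ → Sub a b c t x′ y′ z′ s′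
Sub-trans here τ = τ
Sub-trans (sub₁ σ) τ = sub₁ (Sub-trans σ τ)
Sub-trans (sub₂ σ) τ = sub₂ (Sub-trans σ τ)
Sub-trans (sub₃ σ) τ = sub₃ (Sub-trans σ τ)

labels-sub : ∀ {a b c t x y z s w} → Sub a b c t x y z s → w ∈ labels s → w ∈ labels t
labels-sub here = id
labels-sub (sub₁ σ) = there ∘ ∈-++⁺ˡ ∘ labels-sub σ
labels-sub (sub₂ {t₁ = t₁} σ) = there ∘ ∈-++⁺ʳ (labels t₁) ∘ ∈-++⁺ˡ ∘ labels-sub σ
labels-sub (sub₃ {t₁ = t₁} {t₂} σ) = there ∘ ∈-++⁺ʳ (labels t₁) ∘ ∈-++⁺ʳ (labels t₂) ∘ labels-sub σ

fresh-sub : ∀ {a b c t x y z s} → Fresh a b c t → Sub a b c t x y z s → Fresh x y z s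
fresh-sub fresh here = fresh
fresh-sub fresh (sub₁ σ) = fresh-sub (FreshNode.fresh₁ fresh) σ
fresh-sub fresh (sub₂ σ) = fresh-sub (FreshNode.fresh₂ fresh) σ
fresh-sub fresh (sub₃ σ) = fresh-sub (FreshNode.fresh₃ fresh) σ

interior-closed : ∀ {a b c t x y z s p q} → Fresh a b c t → Sub a b c t x y z s → EdgeIn a b c t p q →
                  p ∈ labels s ⊎ q ∈ labels s → p ∈ vertices x y z s × q ∈ vertices x y z s
interior-closed _ here e _ = edge-ends e
interior-closed fresh (sub₁ σ) e h =
  interior-closed (FreshNode.fresh₁ fresh) σ (FreshNode.edge-in₁ fresh e (Sum.map (labels-sub σ) (labels-sub σ) h)) h
interior-closed fresh (sub₂ σ) e h =
  interior-closed (FreshNode.fresh₂ fresh) σ (FreshNode.edge-in₂ fresh e (Sum.map (labels-sub σ) (labels-sub σ) h)) h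
interior-closed fresh (sub₃ σ) e h =
  interior-closed (FreshNode.fresh₃ fresh) σ (FreshNode.edge-in₃ fresh e (Sum.map (labels-sub σ) (labels-sub σ) h)) h

neighbour-closed : ∀ {a b c t x y z s u w} → Fresh a b c t → Sub a b c t x y z s →
                   Adj a b c t u w → w ∈ labels s → u ∈ vertices x y z s
neighbour-closed fresh σ (inj₁ (inner e)) w∈ = proj₁ (interior-closed fresh σ e (inj₂ w∈))
neighbour-closed fresh σ (inj₂ (inner e)) w∈ = proj₂ (interior-closed fresh σ e (inj₁ w∈))
neighbour-closed fresh σ (inj₁ ab) w∈ = ⊥-elim (outside fresh (there (here refl) , labels-sub σ w∈))
neighbour-closed fresh σ (inj₁ bc) w∈ = ⊥-elim (outside fresh (there (there (here refl)) , labels-sub σ w∈))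
neighbour-closed fresh σ (inj₁ ca) w∈ = ⊥-elim (outside fresh (here refl , labels-sub σ w∈))
neighbour-closed fresh σ (inj₂ ab) w∈ = ⊥-elim (outside fresh (here refl , labels-sub σ w∈))
neighbour-closed fresh σ (inj₂ bc) w∈ = ⊥-elim (outside fresh (there (here refl) , labels-sub σ w∈))
neighbour-closed fresh σ (inj₂ ca) w∈ = ⊥-elim (outside fresh (there (there (here refl)) , labels-sub σ w∈))

interior-enclosed : ∀ {a b c t x y z s} {gates : List ℕ} → Fresh a b c t → Sub a b c t x y z s →
                    x ∈ gates → y ∈ gates → z ∈ gates → Gates.Enclosed (Adj a b c t) gates (labels s)
interior-enclosed fresh σ x∈ y∈ z∈ adj w∈ = corner-or-interior x∈ y∈ z∈ (neighbour-closed fresh σ adj w∈)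

module NineGrandchildren {a b c x y z v v₁ v₂ v₃ : ℕ} {t : Tri} {g₁ g₂ g₃ g₄ g₅ g₆ g₇ g₈ g₉ : Tri}
  (fresh : Fresh a b c t)
  (σ : Sub a b c t x y z (node v (node v₁ g₁ g₂ g₃) (node v₂ g₄ g₅ g₆) (node v₃ g₇ g₈ g₉))) where

  gates : List ℕ
  gates = x ∷ y ∷ z ∷ v ∷ v₁ ∷ v₂ ∷ v₃ ∷ []

  open Gates (Adj a b c t) gates public

  regions : List (List ℕ)
  regions = map labels (g₁ ∷ g₂ ∷ g₃ ∷ g₄ ∷ g₅ ∷ g₆ ∷ g₇ ∷ g₈ ∷ g₉ ∷ [])

  private
    x∈ : x ∈ gates
    x∈ = here refl
    y∈ : y ∈ gates
    y∈ = there (here refl)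
    z∈ : z ∈ gates
    z∈ = there (there (here refl))
    v∈ : v ∈ gates
    v∈ = there (there (there (here refl)))
    v₁∈ : v₁ ∈ gates
    v₁∈ = there (there (there (there (here refl))))
    v₂∈ : v₂ ∈ gates
    v₂∈ = there (there (there (there (there (here refl)))))
    v₃∈ : v₃ ∈ gates
    v₃∈ = there (there (there (there (there (there (here refl))))))

    grandchild : ∀ {x′ y′ z′ s} → Sub x y z (node v (node v₁ g₁ g₂ g₃) (node v₂ g₄ g₅ g₆) (node v₃ g₇ g₈ g₉)) x′ y′ z′ s →
                 x′ ∈ gates → y′ ∈ gates → z′ ∈ gates → Enclosed (labels s)
    grandchild τ = interior-enclosed fresh (Sub-trans σ τ)

  -- Every grandchild has three gates as corners, so its interior is enclosed.
  enclosed : All Enclosed regions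
  enclosed = grandchild (sub₁ (sub₁ here)) v₁∈ y∈ z∈ ∷ grandchild (sub₁ (sub₂ here)) v∈ v₁∈ z∈
           ∷ grandchild (sub₁ (sub₃ here)) v∈ y∈ v₁∈ ∷ grandchild (sub₂ (sub₁ here)) v₂∈ v∈ z∈
           ∷ grandchild (sub₂ (sub₂ here)) x∈ v₂∈ z∈ ∷ grandchild (sub₂ (sub₃ here)) x∈ v∈ v₂∈
           ∷ grandchild (sub₃ (sub₁ here)) v₃∈ y∈ v∈ ∷ grandchild (sub₃ (sub₂ here)) x∈ v₃∈ v∈
           ∷ grandchild (sub₃ (sub₃ here)) x∈ y∈ v₃∈ ∷ []

  -- Dropping v, v₁, v₂, v₃ from the interior of △ leaves the nine interiors side by side.
  disjoint : Unique (concat regions)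
  disjoint = Unique-⊆ (v ∷ʳ skip-before v₁ (labels g₁) (labels g₂) (labels g₃)
                               (skip-before v₂ (labels g₄) (labels g₅) (labels g₆) last-child))
                      (unique (fresh-sub fresh σ))
    where
    last-child : labels g₇ ++ labels g₈ ++ labels g₉ ++ [] ⊆ labels (node v₃ g₇ g₈ g₉)
    last-child = subst (labels g₇ ++ labels g₈ ++ labels g₉ ++ [] ⊆_) (++-identityʳ (labels (node v₃ g₇ g₈ g₉)))
                       (skip-before v₃ (labels g₇) (labels g₈) (labels g₉) [])

lemma6 : (a b c : ℕ) (t : Tri) → WellFormed a b c t →
         (x y z v v₁ v₂ v₃ : ℕ) (g₁ g₂ g₃ g₄ g₅ g₆ g₇ g₈ g₉ : Tri) →
         Sub a b c t x y z (node v (node v₁ g₁ g₂ g₃) (node v₂ g₄ g₅ g₆) (node v₃ g₇ g₈ g₉)) →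
         (p : List ℕ) → IsPath a b c t p →
         ¬ All (Meets p) (g₁ ∷ g₂ ∷ g₃ ∷ g₄ ∷ g₅ ∷ g₆ ∷ g₇ ∷ g₈ ∷ g₉ ∷ [])
lemma6 a b c t wf x y z v v₁ v₂ v₃ g₁ g₂ g₃ g₄ g₅ g₆ g₇ g₈ g₉ σ p (simple , walk , _) meets =
  n≮n 8 nine≤eight
  where
  open NineGrandchildren (wellFormed⇒fresh wf) σ

  -- Nine disjoint enclosed regions are met, but only 7 + 1 are possible.
  nine≤eight : 9 ≤ 8
  nine≤eight = regions-met-bound regions enclosed disjoint simple walk (map⁺ meets)
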